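{- For every $n<\omega$ there exists a finite simple rank $3$ $\wedge$-matroid $M(n)$ of size $6+(n+1)$ and $6$ distinct points $p_1,\dots,p_6\in M(n)$ such that $\langle p_1,\dots,p_6\rangle_{M(n)}=M(n)$, where $\langle A\rangle_B$ denotes the substructure of $B$ generated by $A$. Furthermore, $M(n)$ can be taken so that it does not contain any projective plane.
   Context: A simple matroid of rank $\leq 3$ is a $3$-hypergraph $(V,R)$ with $R$ irreflexive and symmetric such that $R(a,b,c)$ and $R(a,b,d)$ imply every $3$-subset of $\{a,b,c,d\}$ is in $R$; it has rank $3$ if some three distinct points are not in $R$. Lines are $a\vee b:=\{a,b\}\cup\{c:R(a,b,c)\}$ for $a\neq b$. A simple $\wedge$-matroid is $(V,R,\wedge)$ with $\wedge(a,b,c,d)=p$ if $a\neq b$, $c\neq d$, the lines $a\vee b\ne c\vee d$ meet in a point $p\notin\{a,b,c,d\}$, and $\wedge(a,b,c,d)=a$ otherwise. The substructure generated by $A$ is the closure of $A$ under $\wedge$. "Does not contain any projective plane" means no subset of its points, with the induced collinearity, forms a projective plane (a linear space in which any two distinct lines meet in exactly one point and there are four points no three collinear). -}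

module Defs where

open import Data.Nat using (ℕ; suc; _+_)
open import Data.Fin using (Fin; _≟_)
open import Data.Bool using (Bool; true; false; _∨_)
open import Data.Product using (Σ; ∃; ∃-syntax; _×_; _,_)
open import Data.Sum using (_⊎_)
open import Relation.Nullary using (¬_)
open import Relation.Nullary.Decidable using (⌊_⌋)
open import Relation.Binary.PropositionalEquality using (_≡_; _≢_)
open import Function.Definitions using (Injective)

Rel3 : ℕ → Set
Rel3 m = Fin m → Fin m → Fin m → Bool

-- Simple matroid of rank ≤ 3 (as in the paper).
record IsSimpleMatroid {m : ℕ} (R : Rel3 m) : Set where
  field
    -- irreflexive: no triple with a repeated point (together with symmetry)
    irrefl : ∀ a b → R a a b ≡ false
    -- symmetric (these two transpositions generate all permutations)
    sym₁₂  : ∀ a b c → R a b c ≡ R b a c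
    sym₂₃  : ∀ a b c → R a b c ≡ R a c b
    exch   : ∀ a b c d → R a b c ≡ true → R a b d ≡ true → c ≢ d →
             (R a c d ≡ true) × (R b c d ≡ true)

HasRank3 : {m : ℕ} → Rel3 m → Set
HasRank3 {m} R = ∃[ a ] ∃[ b ] ∃[ c ] (a ≢ b × a ≢ c × b ≢ c × R a b c ≡ false)

onLine : {m : ℕ} → Rel3 m → Fin m → Fin m → Fin m → Bool
onLine R a b x = ⌊ x ≟ a ⌋ ∨ ⌊ x ≟ b ⌋ ∨ R a b x

SameLine : {m : ℕ} → Rel3 m → Fin m → Fin m → Fin m → Fin m → Set
SameLine R a b c d = ∀ x → onLine R a b x ≡ onLine R c d x

WedgeMeet : {m : ℕ} → Rel3 m → Fin m → Fin m → Fin m → Fin m → Fin m → Set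
WedgeMeet R a b c d p =
  a ≢ b × c ≢ d × ¬ SameLine R a b c d ×
  onLine R a b p ≡ true × onLine R c d p ≡ true ×
  (∀ q → onLine R a b q ≡ true → onLine R c d q ≡ true → q ≡ p) ×
  p ≢ a × p ≢ b × p ≢ c × p ≢ d

Wedge : {m : ℕ} → Rel3 m → Fin m → Fin m → Fin m → Fin m → Fin m → Set
Wedge R a b c d p =
  WedgeMeet R a b c d p ⊎ ((¬ (∃[ q ] WedgeMeet R a b c d q)) × p ≡ a)

data Generated {m : ℕ} (R : Rel3 m) (A : Fin m → Set) : Fin m → Set where
  base  : ∀ {x} → A x → Generated R A x
  wedge : ∀ {a b c d p} →
          Generated R A a → Generated R A b →
          Generated R A c → Generated R A d →
          Wedge R a b c d p → Generated R A p

-- Induced lines are (a ∨ b) ∩ S for distinct a, b ∈ S;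
-- this is automatically a linear space (any two distinct points of S lie on
-- exactly one induced line, namely (a ∨ b) ∩ S, by the matroid axioms).
InS : {m : ℕ} → (Fin m → Bool) → Fin m → Set
InS S x = S x ≡ true

SameInducedLine : {m : ℕ} → Rel3 m → (Fin m → Bool) →
                  Fin m → Fin m → Fin m → Fin m → Set
SameInducedLine R S a b c d =
  ∀ x → InS S x → onLine R a b x ≡ onLine R c d x

Collinear : {m : ℕ} → Rel3 m → Fin m → Fin m → Fin m → Set
Collinear R a b c = a ≡ b ⊎ a ≡ c ⊎ b ≡ c ⊎ R a b c ≡ true

IsProjectivePlane : {m : ℕ} → Rel3 m → (Fin m → Bool) → Set
IsProjectivePlane R S =
  (∀ a b c d → InS S a → InS S b → InS S c → InS S d →
     a ≢ b → c ≢ d → ¬ SameInducedLine R S a b c d →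
     ∃[ p ] (InS S p × onLine R a b p ≡ true × onLine R c d p ≡ true ×
             (∀ q → InS S q → onLine R a b q ≡ true → onLine R c d q ≡ true →
                q ≡ p))) ×
  (∃[ a ] ∃[ b ] ∃[ c ] ∃[ d ]
     (InS S a × InS S b × InS S c × InS S d ×
      ¬ Collinear R a b c × ¬ Collinear R a b d ×
      ¬ Collinear R a c d × ¬ Collinear R b c d))

ContainsProjectivePlane : {m : ℕ} → Rel3 m → Set
ContainsProjectivePlane {m} R = ∃[ S ] IsProjectivePlane {m} R S

-- M(n) consists of the first 6 + (n+1) points, in the order e, f, b, c, d, y₀₀, y₀₁, y₁₀, y₁₁, …,
-- of a partial linear space: ℓ carries b and the even path points y q false, m carries c, d and
-- the odd ones y q true, and consecutive path points are joined by a line through e or through f,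
-- alternately. Walking along the path, y q true = (y q false ∨ e) ∧ (c ∨ d) and
-- y (q+1) false = (y q true ∨ f) ∧ (y₀₀ ∨ b), so the first six points generate M(n).
-- A projective plane would contain a quadrangle whose six sides are lines of the space. Its
-- vertices cannot be b, c or d, which lie on a single line. Nor e or f: the other three vertices
-- are path points, not all of one parity, and the two sides from the odd one out to the others
-- are that point's lines through e and through f, so one of them passes through the fourth
-- vertex. Finally four path points, two of each parity, would give two even points with two
-- common odd neighbours on the path.
module Submission where

open import Defs
open import Data.Bool using (Bool; true; false; not)
open import Data.Empty using (⊥-elim)
import Data.Fin as Fin
open import Data.Fin using (Fin; toℕ; fromℕ<; _↑ˡ_; #_)
open import Data.Fin.Properties using (toℕ-injective; toℕ-fromℕ<; toℕ<n; toℕ-↑ˡ)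
import Data.Nat as ℕ
open import Data.Nat using (ℕ; zero; suc; _+_; _<_; ⌊_/2⌋)
open import Data.Nat.Properties using (+-suc; suc-injective; n≡⌊n+n/2⌋; 1+n≢n; <-trans; n<1+n)
open import Data.Product using (∃-syntax; ∃₂; _×_; _,_; proj₁; proj₂; uncurry)
open import Data.Sum using (_⊎_; inj₁; inj₂; swap)
open import Function using (_∘_)
open import Function.Bundles using (mk⇔)
open import Function.Definitions using (Injective)
open import Relation.Binary.Definitions using (Decidable)
open import Relation.Binary.PropositionalEquality
open import Relation.Nullary using (¬_; Dec; yes; no; does; contradiction)
open import Relation.Nullary.Decidable using (map′; ¬?; _×-dec_; dec-true; dec-false; does-⇔)

does-sound : ∀ {A : Set} (a? : Dec A) → does a? ≡ true → A
does-sound (yes a) _ = a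

module _ {m : ℕ} (R : Rel3 m) where

  onLine-left : ∀ a b → onLine R a b a ≡ true
  onLine-left a b with a Fin.≟ a
  ... | yes _ = refl
  ... | no a≢a = contradiction refl a≢a

  onLine-cases : ∀ a b x → onLine R a b x ≡ true → x ≡ a ⊎ x ≡ b ⊎ R a b x ≡ true
  onLine-cases a b x x∈ab with x Fin.≟ a | x Fin.≟ b
  ... | yes x≡a | _       = inj₁ x≡a
  ... | no _    | yes x≡b = inj₂ (inj₁ x≡b)
  ... | no _    | no _    = inj₂ (inj₂ x∈ab)

  onLine⇒Collinear : ∀ a b x → onLine R a b x ≡ true → Collinear R a b x
  onLine⇒Collinear a b x x∈ab with onLine-cases a b x x∈ab
  ... | inj₁ x≡a        = inj₂ (inj₁ (sym x≡a))
  ... | inj₂ (inj₁ x≡b) = inj₂ (inj₂ (inj₁ (sym x≡b)))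
  ... | inj₂ (inj₂ abx) = inj₂ (inj₂ (inj₂ abx))

  module _ (M : IsSimpleMatroid R) where
    open IsSimpleMatroid M

    Collinear-swap₂₃ : ∀ {a b c} → Collinear R a b c → Collinear R a c b
    Collinear-swap₂₃ (inj₁ a≡b)               = inj₂ (inj₁ a≡b)
    Collinear-swap₂₃ (inj₂ (inj₁ a≡c))        = inj₁ a≡c
    Collinear-swap₂₃ (inj₂ (inj₂ (inj₁ b≡c))) = inj₂ (inj₂ (inj₁ (sym b≡c)))
    Collinear-swap₂₃ {a} {b} {c} (inj₂ (inj₂ (inj₂ abc))) =
      inj₂ (inj₂ (inj₂ (trans (sym (sym₂₃ a b c)) abc)))

    Collinear-rotate : ∀ {a b c} → Collinear R a b c → Collinear R c a b
    Collinear-rotate (inj₁ a≡b)               = inj₂ (inj₂ (inj₁ a≡b))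
    Collinear-rotate (inj₂ (inj₁ a≡c))        = inj₁ (sym a≡c)
    Collinear-rotate (inj₂ (inj₂ (inj₁ b≡c))) = inj₂ (inj₁ (sym b≡c))
    Collinear-rotate {a} {b} {c} (inj₂ (inj₂ (inj₂ abc))) = inj₂ (inj₂ (inj₂ (begin
      R c a b ≡⟨ sym (sym₁₂ a c b) ⟩
      R a c b ≡⟨ sym (sym₂₃ a b c) ⟩
      R a b c ≡⟨ abc ⟩
      true    ∎)))
      where open ≡-Reasoning

-- join a b is the line through a and b when there is one, and arbitrary otherwise.
record PartialLinearSpace : Set₁ where
  infix 4 _∈_ _∈?_
  field
    Point Line  : Set
    _∈_         : Point → Line → Set
    _∈?_        : Decidable _∈_
    join        : Point → Point → Line
    join-unique : ∀ {a b L} → a ≢ b → a ∈ L → b ∈ L → L ≡ join a b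

module PartialLinearSpaceProperties (space : PartialLinearSpace) where
  open PartialLinearSpace space

  Joined : Point → Point → Set
  Joined a b = ∃[ L ] a ∈ L × b ∈ L

  OnALine : Point → Point → Point → Set
  OnALine a b c = ∃[ L ] a ∈ L × b ∈ L × c ∈ L

  Triangle : Point → Point → Point → Set
  Triangle a b c = Joined a b × Joined a c × Joined b c × ¬ OnALine a b c

  CompleteQuadrangle : Point → Point → Point → Point → Set
  CompleteQuadrangle a b c d = Triangle a b c × Triangle a b d × Triangle a c d × Triangle b c d

  same-line : ∀ {a b L L′} → a ≢ b → a ∈ L → b ∈ L → a ∈ L′ → b ∈ L′ → L ≡ L′
  same-line a≢b a∈L b∈L a∈L′ b∈L′ = trans (join-unique a≢b a∈L b∈L) (sym (join-unique a≢b a∈L′ b∈L′))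

  onALine? : ∀ {a b} → a ≢ b → ∀ c → Dec (OnALine a b c)
  onALine? {a} {b} a≢b c =
    map′ (λ (a∈ , b∈ , c∈) → join a b , a∈ , b∈ , c∈)
         (λ (L , a∈ , b∈ , c∈) → subst (λ L → a ∈ L × b ∈ L × c ∈ L) (join-unique a≢b a∈ b∈) (a∈ , b∈ , c∈))
         (a ∈? join a b ×-dec b ∈? join a b ×-dec c ∈? join a b)

  Joined-sym : ∀ {a b} → Joined a b → Joined b a
  Joined-sym (L , a∈ , b∈) = L , b∈ , a∈

  triangle-rotate : ∀ {a b c} → Triangle a b c → Triangle b c a
  triangle-rotate (ab , ac , bc , ¬abc) =
    bc , Joined-sym ab , Joined-sym ac , λ (L , b∈ , c∈ , a∈) → ¬abc (L , a∈ , b∈ , c∈)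

  triangle-swap₂₃ : ∀ {a b c} → Triangle a b c → Triangle a c b
  triangle-swap₂₃ (ab , ac , bc , ¬abc) =
    ac , ab , Joined-sym bc , λ (L , a∈ , c∈ , b∈) → ¬abc (L , a∈ , b∈ , c∈)

  triangle-distinct : ∀ {a b c} → Triangle a b c → a ≢ b
  triangle-distinct (_ , (L , a∈ , c∈) , _ , ¬abc) refl = ¬abc (L , a∈ , a∈ , c∈)

  quadrangle-rotate : ∀ {a b c d} → CompleteQuadrangle a b c d → CompleteQuadrangle b c d a
  quadrangle-rotate (abc , abd , acd , bcd) =
    bcd , triangle-rotate abc , triangle-rotate abd , triangle-rotate acd

  quadrangle-swap₂₃ : ∀ {a b c d} → CompleteQuadrangle a b c d → CompleteQuadrangle a c b d
  quadrangle-swap₂₃ (abc , abd , acd , bcd) =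
    triangle-swap₂₃ abc , acd , abd , triangle-swap₂₃ (triangle-rotate bcd)

  single-line-not-vertex : ∀ {a b c} → (∀ {L L′} → a ∈ L → a ∈ L′ → L ≡ L′) → ¬ Triangle a b c
  single-line-not-vertex unique ((L , a∈L , b∈L) , (L′ , a∈L′ , c∈L′) , _ , ¬abc) =
    ¬abc (L , a∈L , b∈L , subst (_ ∈_) (unique a∈L′ a∈L) c∈L′)

module Restriction (space : PartialLinearSpace) {N : ℕ}
                   (ι : Fin N → PartialLinearSpace.Point space)
                   (ι-injective : Injective _≡_ _≡_ ι) where
  open PartialLinearSpace space
  open PartialLinearSpaceProperties space

  ι-≢ : ∀ {x y} → x ≢ y → ι x ≢ ι y
  ι-≢ x≢y = x≢y ∘ ι-injective

  ≢-of-ι : ∀ {x y} → ι x ≢ ι y → x ≢ y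
  ≢-of-ι ιx≢ιy = ιx≢ιy ∘ cong ι

  DistinctCollinear : Fin N → Fin N → Fin N → Set
  DistinctCollinear x y z = x ≢ y × x ≢ z × y ≢ z × OnALine (ι x) (ι y) (ι z)

  distinctCollinear? : ∀ x y z → Dec (DistinctCollinear x y z)
  distinctCollinear? x y z with x Fin.≟ y
  ... | yes x≡y = no λ (x≢y , _) → x≢y x≡y
  ... | no x≢y  = map′ (x≢y ,_) proj₂
                       (¬? (x Fin.≟ z) ×-dec ¬? (y Fin.≟ z) ×-dec onALine? (ι-≢ x≢y) (ι z))

  rel : Rel3 N
  rel x y z = does (distinctCollinear? x y z)

  rel-sound : ∀ x y z → rel x y z ≡ true → DistinctCollinear x y z
  rel-sound x y z = does-sound (distinctCollinear? x y z)

  rel-complete : ∀ x y z → DistinctCollinear x y z → rel x y z ≡ true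
  rel-complete x y z = dec-true (distinctCollinear? x y z)

  distinctCollinear-swap₁₂ : ∀ {x y z} → DistinctCollinear x y z → DistinctCollinear y x z
  distinctCollinear-swap₁₂ (x≢y , x≢z , y≢z , L , x∈ , y∈ , z∈) =
    x≢y ∘ sym , y≢z , x≢z , L , y∈ , x∈ , z∈

  distinctCollinear-swap₂₃ : ∀ {x y z} → DistinctCollinear x y z → DistinctCollinear x z y
  distinctCollinear-swap₂₃ (x≢y , x≢z , y≢z , L , x∈ , y∈ , z∈) =
    x≢z , x≢y , y≢z ∘ sym , L , x∈ , z∈ , y∈

  isSimpleMatroid : IsSimpleMatroid rel
  isSimpleMatroid = record
    { irrefl = λ a b → dec-false (distinctCollinear? a a b) λ (a≢a , _) → a≢a refl
    ; sym₁₂  = λ a b c → does-⇔ (mk⇔ distinctCollinear-swap₁₂ distinctCollinear-swap₁₂)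
                   (distinctCollinear? a b c) (distinctCollinear? b a c)
    ; sym₂₃  = λ a b c → does-⇔ (mk⇔ distinctCollinear-swap₂₃ distinctCollinear-swap₂₃)
                   (distinctCollinear? a b c) (distinctCollinear? a c b)
    ; exch   = exch
    }
    where
    exch : ∀ a b c d → rel a b c ≡ true → rel a b d ≡ true → c ≢ d →
           (rel a c d ≡ true) × (rel b c d ≡ true)
    exch a b c d abc abd c≢d with rel-sound a b c abc | rel-sound a b d abd
    ... | a≢b , a≢c , b≢c , L , a∈ , b∈ , c∈ | _ , a≢d , b≢d , L′ , a∈′ , b∈′ , d∈′ =
      rel-complete a c d (a≢c , a≢d , c≢d , L , a∈ , c∈ , d∈) ,
      rel-complete b c d (b≢c , b≢d , c≢d , L , b∈ , c∈ , d∈)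
      where
      d∈ = subst (_ ∈_) (same-line (ι-≢ a≢b) a∈′ b∈′ a∈ b∈) d∈′

  onLine⇒∈ : ∀ {a b x L} → ι a ≢ ι b → ι a ∈ L → ι b ∈ L → onLine rel a b x ≡ true → ι x ∈ L
  onLine⇒∈ {a} {b} {x} ιa≢ιb a∈ b∈ x∈ab with onLine-cases rel a b x x∈ab
  ... | inj₁ refl        = a∈
  ... | inj₂ (inj₁ refl) = b∈
  ... | inj₂ (inj₂ abx) with rel-sound a b x abx
  ... | _ , _ , _ , L′ , a∈′ , b∈′ , x∈′ = subst (_ ∈_) (same-line ιa≢ιb a∈′ b∈′ a∈ b∈) x∈′

  ∈⇒onLine : ∀ {a b x L} → ι a ≢ ι b → ι a ∈ L → ι b ∈ L → ι x ∈ L → onLine rel a b x ≡ true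
  ∈⇒onLine {a} {b} {x} ιa≢ιb a∈ b∈ x∈ with x Fin.≟ a | x Fin.≟ b
  ... | yes _   | _      = refl
  ... | no _    | yes _  = refl
  ... | no x≢a  | no x≢b =
    rel-complete a b x (≢-of-ι ιa≢ιb , x≢a ∘ sym , x≢b ∘ sym , _ , a∈ , b∈ , x∈)

  wedgeMeet : ∀ {a b c d p L₁ L₂} → L₁ ≢ L₂ →
    ι a ∈ L₁ → ι b ∈ L₁ → ι p ∈ L₁ → ι c ∈ L₂ → ι d ∈ L₂ → ι p ∈ L₂ →
    ι a ≢ ι b → ι c ≢ ι d → ι p ≢ ι a → ι p ≢ ι b → ι p ≢ ι c → ι p ≢ ι d →
    WedgeMeet rel a b c d p
  wedgeMeet {a} {b} {c} {d} {p} L₁≢L₂ a∈ b∈ p∈₁ c∈ d∈ p∈₂ a≢b c≢d p≢a p≢b p≢c p≢d =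
    ≢-of-ι a≢b , ≢-of-ι c≢d , different ,
    ∈⇒onLine a≢b a∈ b∈ p∈₁ , ∈⇒onLine c≢d c∈ d∈ p∈₂ , unique ,
    ≢-of-ι p≢a , ≢-of-ι p≢b , ≢-of-ι p≢c , ≢-of-ι p≢d
    where
    different : ¬ SameLine rel a b c d
    different same = L₁≢L₂ (same-line a≢b a∈ b∈ (on₂ a∈) (on₂ b∈))
      where
      on₂ : ∀ {x} → ι x ∈ _ → ι x ∈ _
      on₂ {x} x∈ = onLine⇒∈ c≢d c∈ d∈ (trans (sym (same x)) (∈⇒onLine a≢b a∈ b∈ x∈))
    unique : ∀ q → onLine rel a b q ≡ true → onLine rel c d q ≡ true → q ≡ p
    unique q q∈ab q∈cd with q Fin.≟ p
    ... | yes q≡p = q≡p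
    ... | no q≢p  = contradiction
      (same-line (ι-≢ q≢p) (onLine⇒∈ a≢b a∈ b∈ q∈ab) p∈₁ (onLine⇒∈ c≢d c∈ d∈ q∈cd) p∈₂) L₁≢L₂

  GeneratedPoint : (Fin N → Set) → Point → Set
  GeneratedPoint A a = ∃[ x ] ι x ≡ a × Generated rel A x

  generated-of-point : ∀ {A x} → GeneratedPoint A (ι x) → Generated rel A x
  generated-of-point (_ , ιx′≡ιx , gen) = subst (Generated rel _) (ι-injective ιx′≡ιx) gen

  meet-generated : ∀ {A a b c d p L₁ L₂} → L₁ ≢ L₂ →
    a ∈ L₁ → b ∈ L₁ → p ∈ L₁ → c ∈ L₂ → d ∈ L₂ → p ∈ L₂ →
    a ≢ b → c ≢ d → p ≢ a → p ≢ b → p ≢ c → p ≢ d →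
    GeneratedPoint A a → GeneratedPoint A b → GeneratedPoint A c → GeneratedPoint A d →
    (∃[ x ] ι x ≡ p) → GeneratedPoint A p
  meet-generated L₁≢L₂ a∈ b∈ p∈₁ c∈ d∈ p∈₂ a≢b c≢d p≢a p≢b p≢c p≢d
                 (_ , refl , ga) (_ , refl , gb) (_ , refl , gc) (_ , refl , gd) (x , refl) =
    x , refl ,
    wedge ga gb gc gd (inj₁ (wedgeMeet L₁≢L₂ a∈ b∈ p∈₁ c∈ d∈ p∈₂ a≢b c≢d p≢a p≢b p≢c p≢d))

  ¬Collinear⇒¬OnALine : ∀ {a b c} → ¬ Collinear rel a b c → ¬ OnALine (ι a) (ι b) (ι c)
  ¬Collinear⇒¬OnALine {a} {b} {c} ¬abc abc =
    ¬abc (inj₂ (inj₂ (inj₂ (rel-complete a b c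
      (¬abc ∘ inj₁ , ¬abc ∘ inj₂ ∘ inj₁ , ¬abc ∘ inj₂ ∘ inj₂ ∘ inj₁ , abc)))))

  rel⇒Joined : ∀ a b p → rel a b p ≡ true → Joined (ι a) (ι b)
  rel⇒Joined a b p abp with rel-sound a b p abp
  ... | _ , _ , _ , L , a∈ , b∈ , _ = L , a∈ , b∈

  third-point : ∀ a b c d p → onLine rel a b p ≡ true → onLine rel c d p ≡ true →
                ¬ Collinear rel c d a → ¬ Collinear rel c d b → rel a b p ≡ true
  third-point a b c d p p∈ab p∈cd ¬cda ¬cdb with onLine-cases rel a b p p∈ab
  ... | inj₁ refl        = contradiction (onLine⇒Collinear rel c d a p∈cd) ¬cda
  ... | inj₂ (inj₁ refl) = contradiction (onLine⇒Collinear rel c d b p∈cd) ¬cdb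
  ... | inj₂ (inj₂ abp)  = abp

  ¬SameInducedLine : ∀ {S} a b c d → InS S c → ¬ Collinear rel a b c → ¬ SameInducedLine rel S a b c d
  ¬SameInducedLine a b c d Sc ¬abc same =
    ¬abc (onLine⇒Collinear rel a b c (trans (same c Sc) (onLine-left rel c d)))

  -- The meet of ab and cd is a third point on both lines, so a and b lie on a line of the
  -- space and not just on the two-point line {a, b} of the matroid.
  diagonal-joins : ∀ {S a b c d} → IsProjectivePlane rel S →
    InS S a → InS S b → InS S c → InS S d →
    ¬ Collinear rel a b c → ¬ Collinear rel a b d → ¬ Collinear rel c d a → ¬ Collinear rel c d b →
    Joined (ι a) (ι b) × Joined (ι c) (ι d)
  diagonal-joins {a = a} {b} {c} {d} (meet , _) Sa Sb Sc Sd ¬abc ¬abd ¬cda ¬cdb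
    with meet a b c d Sa Sb Sc Sd (¬abc ∘ inj₁) (¬cda ∘ inj₁) (¬SameInducedLine a b c d Sc ¬abc)
  ... | p , _ , p∈ab , p∈cd , _ =
    rel⇒Joined a b p (third-point a b c d p p∈ab p∈cd ¬cda ¬cdb) ,
    rel⇒Joined c d p (third-point c d a b p p∈cd p∈ab ¬abc ¬abd)

  plane⇒quadrangle : ContainsProjectivePlane rel →
    ∃[ a ] ∃[ b ] ∃[ c ] ∃[ d ] CompleteQuadrangle (ι a) (ι b) (ι c) (ι d)
  plane⇒quadrangle (_ , plane@(_ , a , b , c , d , Sa , Sb , Sc , Sd , ¬abc , ¬abd , ¬acd , ¬bcd)) =
    a , b , c , d ,
    (ab , ac , bc , ¬OnALine ¬abc) , (ab , ad , bd , ¬OnALine ¬abd) ,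
    (ac , ad , cd , ¬OnALine ¬acd) , (bc , bd , cd , ¬OnALine ¬bcd)
    where
    rotate : ∀ {x y z} → ¬ Collinear rel x y z → ¬ Collinear rel y z x
    rotate ¬xyz = ¬xyz ∘ Collinear-rotate rel isSimpleMatroid
    swap₂₃ : ∀ {x y z} → ¬ Collinear rel x y z → ¬ Collinear rel x z y
    swap₂₃ ¬xyz = ¬xyz ∘ Collinear-swap₂₃ rel isSimpleMatroid
    ¬OnALine = ¬Collinear⇒¬OnALine
    ab×cd = diagonal-joins plane Sa Sb Sc Sd ¬abc ¬abd (rotate ¬acd) (rotate ¬bcd)
    ac×bd = diagonal-joins plane Sa Sc Sb Sd (swap₂₃ ¬abc) ¬acd (rotate ¬abd) (swap₂₃ ¬bcd)
    ad×bc = diagonal-joins plane Sa Sd Sb Sc (swap₂₃ ¬abd) (swap₂₃ ¬acd) (rotate ¬abc) ¬bcd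
    ab = proj₁ ab×cd
    cd = proj₂ ab×cd
    ac = proj₁ ac×bd
    bd = proj₂ ac×bd
    ad = proj₁ ad×bc
    bc = proj₂ ad×bc

-- y q r is the (2q + r)-th point of the path.
data Point : Set where
  e f b c d : Point
  y : ℕ → Bool → Point

data Line : Set where
  ℓ m : Line
  E F : ℕ → Line

infix 4 _∈_ _∈?_

data _∈_ : Point → Line → Set where
  b∈ℓ  : b ∈ ℓ
  y∈ℓ  : ∀ {q} → y q false ∈ ℓ
  c∈m  : c ∈ m
  d∈m  : d ∈ m
  y∈m  : ∀ {q} → y q true ∈ m
  e∈E  : ∀ {k} → e ∈ E k
  y∈E  : ∀ {k r} → y k r ∈ E k
  f∈F  : ∀ {k} → f ∈ F k
  y∈F  : ∀ {k} → y k true ∈ F k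
  y′∈F : ∀ {k} → y (suc k) false ∈ F k

_∈?_ : Decidable _∈_
b ∈? ℓ = yes b∈ℓ
y _ false ∈? ℓ = yes y∈ℓ
c ∈? m = yes c∈m
d ∈? m = yes d∈m
y _ true ∈? m = yes y∈m
e ∈? E _ = yes e∈E
y q _ ∈? E k = map′ (λ { refl → y∈E }) (λ { y∈E → refl }) (q ℕ.≟ k)
f ∈? F _ = yes f∈F
y q true ∈? F k = map′ (λ { refl → y∈F }) (λ { y∈F → refl }) (q ℕ.≟ k)
y (suc q) false ∈? F k = map′ (λ { refl → y′∈F }) (λ { y′∈F → refl }) (q ℕ.≟ k)
y zero false ∈? F _ = no λ ()
y _ true ∈? ℓ = no λ ()
y _ false ∈? m = no λ ()
e ∈? ℓ = no λ ()
e ∈? m = no λ ()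
e ∈? F _ = no λ ()
f ∈? ℓ = no λ ()
f ∈? m = no λ ()
f ∈? E _ = no λ ()
b ∈? m = no λ ()
b ∈? E _ = no λ ()
b ∈? F _ = no λ ()
c ∈? ℓ = no λ ()
c ∈? E _ = no λ ()
c ∈? F _ = no λ ()
d ∈? ℓ = no λ ()
d ∈? E _ = no λ ()
d ∈? F _ = no λ ()

-- the line through y q false and y w true, if they are joined
crossLine : ℕ → ℕ → Line
crossLine q w with q ℕ.≟ w
... | yes _ = E q
... | no _  = F w

crossLine-E : ∀ k → crossLine k k ≡ E k
crossLine-E k with k ℕ.≟ k
... | yes _   = refl
... | no k≢k  = contradiction refl k≢k

crossLine-F : ∀ k → crossLine (suc k) k ≡ F k
crossLine-F k with suc k ℕ.≟ k
... | yes 1+k≡k = contradiction 1+k≡k 1+n≢n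
... | no _      = refl

join : Point → Point → Line
join b _ = ℓ
join c _ = m
join d _ = m
join e (y q _) = E q
join f (y q true) = F q
join f (y (suc q) false) = F q
join (y q _) e = E q
join (y q true) f = F q
join (y (suc q) false) f = F q
join (y q false) (y w true) = crossLine q w
join (y q true) (y w false) = crossLine w q
join (y _ true) _ = m
join _ _ = ℓ

join-unique : ∀ {a b L} → a ≢ b → a ∈ L → b ∈ L → L ≡ join a b
join-unique _ b∈ℓ _ = refl
join-unique _ c∈m _ = refl
join-unique _ d∈m _ = refl
join-unique _ y∈ℓ b∈ℓ = refl
join-unique _ y∈ℓ y∈ℓ = refl
join-unique _ y∈m c∈m = refl
join-unique _ y∈m d∈m = refl
join-unique _ y∈m y∈m = refl
join-unique a≢b e∈E e∈E = contradiction refl a≢b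
join-unique _ e∈E y∈E = refl
join-unique _ y∈E e∈E = refl
join-unique a≢b (y∈E {r = false}) (y∈E {r = false}) = contradiction refl a≢b
join-unique _ (y∈E {k} {false}) (y∈E {r = true}) = sym (crossLine-E k)
join-unique _ (y∈E {k} {true}) (y∈E {r = false}) = sym (crossLine-E k)
join-unique a≢b (y∈E {r = true}) (y∈E {r = true}) = contradiction refl a≢b
join-unique a≢b f∈F f∈F = contradiction refl a≢b
join-unique _ f∈F y∈F = refl
join-unique _ f∈F y′∈F = refl
join-unique _ y∈F f∈F = refl
join-unique _ y′∈F f∈F = refl
join-unique a≢b y∈F y∈F = contradiction refl a≢b
join-unique a≢b y′∈F y′∈F = contradiction refl a≢b
join-unique _ (y∈F {k}) y′∈F = sym (crossLine-F k)
join-unique _ (y′∈F {k}) y∈F = sym (crossLine-F k)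

geometry : PartialLinearSpace
geometry = record
  { Point = Point ; Line = Line ; _∈_ = _∈_ ; _∈?_ = _∈?_ ; join = join ; join-unique = join-unique }

open PartialLinearSpaceProperties geometry

IsPathPoint : Point → Set
IsPathPoint p = ∃₂ λ q r → p ≡ y q r

data Centre : Point → Set where
  centre-e : Centre e
  centre-f : Centre f

centre-neighbour : ∀ {p u} → Centre p → Joined p u → p ≢ u → IsPathPoint u
centre-neighbour centre-e (_ , e∈E , e∈E)  e≢e = contradiction refl e≢e
centre-neighbour centre-e (_ , e∈E , y∈E)  _   = _ , _ , refl
centre-neighbour centre-f (_ , f∈F , f∈F)  f≢f = contradiction refl f≢f
centre-neighbour centre-f (_ , f∈F , y∈F)  _   = _ , _ , refl
centre-neighbour centre-f (_ , f∈F , y′∈F) _   = _ , _ , refl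

cross-line : ∀ {q r w L} → y q r ∈ L → y w (not r) ∈ L → e ∈ L ⊎ f ∈ L
cross-line y∈ℓ ()
cross-line y∈m ()
cross-line y∈E y∈E = inj₁ e∈E
cross-line y∈F y′∈F = inj₂ f∈F
cross-line y′∈F y∈F = inj₂ f∈F

centre-on : ∀ {p L L′} → Centre p → e ∈ L → f ∈ L′ → p ∈ L ⊎ p ∈ L′
centre-on centre-e e∈L _ = inj₁ e∈L
centre-on centre-f _ f∈L′ = inj₂ f∈L′

-- A path point lies on one line through e and at most one through f, so two
-- distinct lines joining it to points of the other parity pass through e and f.
centre-on-side : ∀ {p q r i j L₁ L₂} → Centre p →
  y q r ∈ L₁ → y i (not r) ∈ L₁ → y q r ∈ L₂ → y j (not r) ∈ L₂ → L₁ ≢ L₂ → p ∈ L₁ ⊎ p ∈ L₂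
centre-on-side centre z₁ u₁ z₂ v₂ L₁≢L₂ with cross-line z₁ u₁ | cross-line z₂ v₂
... | inj₁ e₁ | inj₁ e₂ = contradiction (same-line (λ ()) e₁ z₁ e₂ z₂) L₁≢L₂
... | inj₂ f₁ | inj₂ f₂ = contradiction (same-line (λ ()) f₁ z₁ f₂ z₂) L₁≢L₂
... | inj₁ e₁ | inj₂ f₂ = centre-on centre e₁ f₂
... | inj₂ f₁ | inj₁ e₂ = swap (centre-on centre e₂ f₁)

centre-triangle : ∀ {p q r i j} → Centre p →
  Triangle p (y i (not r)) (y q r) → Triangle p (y j (not r)) (y q r) →
  ¬ Triangle (y i (not r)) (y j (not r)) (y q r)
centre-triangle centre (_ , _ , _ , ¬puz) (_ , _ , _ , ¬pvz) (_ , (L₁ , u₁ , z₁) , (L₂ , v₂ , z₂) , ¬uvz)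
  with centre-on-side centre z₁ u₁ z₂ v₂ (λ L₁≡L₂ → ¬uvz (L₁ , u₁ , subst (_ ∈_) (sym L₁≡L₂) v₂ , z₁))
... | inj₁ p∈L₁ = ¬puz (L₁ , p∈L₁ , u₁ , z₁)
... | inj₂ p∈L₂ = ¬pvz (L₂ , p∈L₂ , v₂ , z₂)

centre-path-quadrangle : ∀ {p i j k} → Centre p → ∀ r s t → ¬ CompleteQuadrangle p (y i r) (y j s) (y k t)
centre-path-quadrangle _ false false false (_ , _ , _ , (_ , _ , _ , ¬abc)) = ¬abc (ℓ , y∈ℓ , y∈ℓ , y∈ℓ)
centre-path-quadrangle _ true  true  true  (_ , _ , _ , (_ , _ , _ , ¬abc)) = ¬abc (m , y∈m , y∈m , y∈m)
centre-path-quadrangle ct false false true  (_ , pac , pbc , abc) = centre-triangle ct pac pbc abc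
centre-path-quadrangle ct true  true  false (_ , pac , pbc , abc) = centre-triangle ct pac pbc abc
centre-path-quadrangle ct false true  false (pab , _ , pbc , abc) =
  centre-triangle ct pab (triangle-swap₂₃ pbc) (triangle-swap₂₃ abc)
centre-path-quadrangle ct true  false true  (pab , _ , pbc , abc) =
  centre-triangle ct pab (triangle-swap₂₃ pbc) (triangle-swap₂₃ abc)
centre-path-quadrangle ct true  false false (pab , pac , _ , abc) =
  centre-triangle ct (triangle-swap₂₃ pab) (triangle-swap₂₃ pac) (triangle-rotate abc)
centre-path-quadrangle ct false true  true  (pab , pac , _ , abc) =
  centre-triangle ct (triangle-swap₂₃ pab) (triangle-swap₂₃ pac) (triangle-rotate abc)

centre-not-vertex : ∀ {p u v w} → Centre p → ¬ CompleteQuadrangle p u v w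
centre-not-vertex centre Q@(puv , puw , pvw , _)
  with neighbour puv | neighbour pvw | neighbour (triangle-swap₂₃ puw)
  where
  neighbour : ∀ {u v} → Triangle _ u v → IsPathPoint u
  neighbour t = centre-neighbour centre (proj₁ t) (triangle-distinct t)
... | _ , r , refl | _ , s , refl | _ , t , refl = centre-path-quadrangle centre r s t Q

Adjacent : ℕ → ℕ → Set
Adjacent x w = w ≡ x ⊎ suc w ≡ x

joined-adjacent : ∀ {x w L} → y x false ∈ L → y w true ∈ L → Adjacent x w
joined-adjacent y∈ℓ ()
joined-adjacent y∈E y∈E = inj₁ refl
joined-adjacent y′∈F y∈F = inj₂ refl

neighbours-sum : ∀ {x₁ x₂ w} → Adjacent x₁ w → Adjacent x₂ w → x₁ ≢ x₂ → x₁ + x₂ ≡ suc (w + w)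
neighbours-sum (inj₁ refl) (inj₁ refl) x≢x = contradiction refl x≢x
neighbours-sum {w = w} (inj₁ refl) (inj₂ refl) _ = +-suc w w
neighbours-sum (inj₂ refl) (inj₁ refl) _ = refl
neighbours-sum (inj₂ refl) (inj₂ refl) x≢x = contradiction refl x≢x

double-injective : ∀ {u v} → u + u ≡ v + v → u ≡ v
double-injective {u} {v} eq = trans (n≡⌊n+n/2⌋ u) (trans (cong ⌊_/2⌋ eq) (sym (n≡⌊n+n/2⌋ v)))

-- Two distinct even points have at most one common neighbour of odd parity.
¬even-even-odd-odd : ∀ {x₁ x₂ w₁ w₂} → ¬ CompleteQuadrangle (y x₁ false) (y x₂ false) (y w₁ true) (y w₂ true)
¬even-even-odd-odd (abc@(_ , (_ , a₁ , c₁) , (_ , b₁ , c₂) , _) , (_ , (_ , a₂ , d₁) , (_ , b₂ , d₂) , _) , acd , _) =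
  triangle-distinct (triangle-rotate acd) (cong (λ w → y w true) (double-injective (suc-injective
    (trans (sym (neighbours-sum (joined-adjacent a₁ c₁) (joined-adjacent b₁ c₂) x₁≢x₂))
           (neighbours-sum (joined-adjacent a₂ d₁) (joined-adjacent b₂ d₂) x₁≢x₂)))))
  where
  x₁≢x₂ = triangle-distinct abc ∘ cong (λ x → y x false)

path-quadrangle : ∀ {q₁ q₂ q₃ q₄} r₁ r₂ r₃ r₄ → ¬ CompleteQuadrangle (y q₁ r₁) (y q₂ r₂) (y q₃ r₃) (y q₄ r₄)
path-quadrangle false false false _     ((_ , _ , _ , ¬abc) , _) = ¬abc (ℓ , y∈ℓ , y∈ℓ , y∈ℓ)
path-quadrangle true  true  true  _     ((_ , _ , _ , ¬abc) , _) = ¬abc (m , y∈m , y∈m , y∈m)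
path-quadrangle false false true  false (_ , (_ , _ , _ , ¬abd) , _) = ¬abd (ℓ , y∈ℓ , y∈ℓ , y∈ℓ)
path-quadrangle true  true  false true  (_ , (_ , _ , _ , ¬abd) , _) = ¬abd (m , y∈m , y∈m , y∈m)
path-quadrangle false true  false false (_ , _ , (_ , _ , _ , ¬acd) , _) = ¬acd (ℓ , y∈ℓ , y∈ℓ , y∈ℓ)
path-quadrangle true  false true  true  (_ , _ , (_ , _ , _ , ¬acd) , _) = ¬acd (m , y∈m , y∈m , y∈m)
path-quadrangle true  false false false (_ , _ , _ , (_ , _ , _ , ¬bcd)) = ¬bcd (ℓ , y∈ℓ , y∈ℓ , y∈ℓ)
path-quadrangle false true  true  true  (_ , _ , _ , (_ , _ , _ , ¬bcd)) = ¬bcd (m , y∈m , y∈m , y∈m)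
path-quadrangle false false true  true  Q = ¬even-even-odd-odd Q
path-quadrangle true  true  false false Q = ¬even-even-odd-odd (quadrangle-rotate (quadrangle-rotate Q))
path-quadrangle false true  false true  Q = ¬even-even-odd-odd (quadrangle-swap₂₃ Q)
path-quadrangle true  false true  false Q = ¬even-even-odd-odd (quadrangle-swap₂₃ (quadrangle-rotate Q))
path-quadrangle false true  true  false Q = ¬even-even-odd-odd (quadrangle-rotate (quadrangle-rotate (quadrangle-rotate Q)))
path-quadrangle true  false false true  Q = ¬even-even-odd-odd (quadrangle-rotate Q)

vertex-on-path : ∀ {p u v w} → CompleteQuadrangle p u v w → IsPathPoint p
vertex-on-path {e} Q = ⊥-elim (centre-not-vertex centre-e Q)
vertex-on-path {f} Q = ⊥-elim (centre-not-vertex centre-f Q)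
vertex-on-path {b} (t , _) = ⊥-elim (single-line-not-vertex (λ { b∈ℓ b∈ℓ → refl }) t)
vertex-on-path {c} (t , _) = ⊥-elim (single-line-not-vertex (λ { c∈m c∈m → refl }) t)
vertex-on-path {d} (t , _) = ⊥-elim (single-line-not-vertex (λ { d∈m d∈m → refl }) t)
vertex-on-path {y q r} _ = q , r , refl

no-complete-quadrangle : ∀ {p u v w} → ¬ CompleteQuadrangle p u v w
no-complete-quadrangle Q
  with vertex-on-path Q | vertex-on-path (quadrangle-rotate Q)
     | vertex-on-path (quadrangle-rotate (quadrangle-rotate Q))
     | vertex-on-path (quadrangle-rotate (quadrangle-rotate (quadrangle-rotate Q)))
... | _ , r₁ , refl | _ , r₂ , refl | _ , r₃ , refl | _ , r₄ , refl = path-quadrangle r₁ r₂ r₃ r₄ Q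

pathStep : ℕ × Bool → ℕ × Bool
pathStep (q , false) = q , true
pathStep (q , true)  = suc q , false

pathCoordinates : ℕ → ℕ × Bool
pathCoordinates zero    = 0 , false
pathCoordinates (suc j) = pathStep (pathCoordinates j)

pathIndex : ℕ × Bool → ℕ
pathIndex (q , false) = q + q
pathIndex (q , true)  = suc (q + q)

pathIndex-step : ∀ h → pathIndex (pathStep h) ≡ suc (pathIndex h)
pathIndex-step (q , false) = refl
pathIndex-step (q , true)  = cong suc (+-suc q q)

pathIndex-coordinates : ∀ j → pathIndex (pathCoordinates j) ≡ j
pathIndex-coordinates zero    = refl
pathIndex-coordinates (suc j) =
  trans (pathIndex-step (pathCoordinates j)) (cong suc (pathIndex-coordinates j))

point : ℕ → Point
point 0 = e
point 1 = f
point 2 = b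
point 3 = c
point 4 = d
point (suc (suc (suc (suc (suc j))))) = uncurry y (pathCoordinates j)

index : Point → ℕ
index e = 0
index f = 1
index b = 2
index c = 3
index d = 4
index (y q r) = 5 + pathIndex (q , r)

index-point : ∀ u → index (point u) ≡ u
index-point 0 = refl
index-point 1 = refl
index-point 2 = refl
index-point 3 = refl
index-point 4 = refl
index-point (suc (suc (suc (suc (suc j))))) = cong (5 +_) (pathIndex-coordinates j)

module Construction (n : ℕ) where
  N : ℕ
  N = 6 + suc n

  ι : Fin N → Point
  ι = point ∘ toℕ

  ι-injective : Injective _≡_ _≡_ ι
  ι-injective {x} {x′} ιx≡ιx′ =
    toℕ-injective (trans (sym (index-point (toℕ x))) (trans (cong index ιx≡ιx′) (index-point (toℕ x′))))

  open Restriction geometry ι ι-injective public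

  generator : Fin 6 → Fin N
  generator i = i ↑ˡ suc n

  generator-injective : Injective _≡_ _≡_ generator
  generator-injective {i} {i′} eq =
    toℕ-injective (trans (sym (toℕ-↑ˡ i (suc n))) (trans (cong toℕ eq) (toℕ-↑ˡ i′ (suc n))))

  Generators : Fin N → Set
  Generators x = ∃[ i ] generator i ≡ x

  generator-point : ∀ i → GeneratedPoint Generators (point (toℕ i))
  generator-point i = generator i , cong point (toℕ-↑ˡ i (suc n)) , base (i , refl)

  step-generated : ∀ h → GeneratedPoint Generators (uncurry y h) →
                   (∃[ x ] ι x ≡ uncurry y (pathStep h)) → GeneratedPoint Generators (uncurry y (pathStep h))
  step-generated (q , false) gen =
    meet-generated {L₁ = E q} {L₂ = m} (λ ()) y∈E e∈E y∈E c∈m d∈m y∈m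
      (λ ()) (λ ()) (λ ()) (λ ()) (λ ()) (λ ())
      gen (generator-point (# 0)) (generator-point (# 3)) (generator-point (# 4))
  step-generated (q , true) gen =
    meet-generated {L₁ = F q} {L₂ = ℓ} (λ ()) y∈F f∈F y′∈F y∈ℓ b∈ℓ y∈ℓ
      (λ ()) (λ ()) (λ ()) (λ ()) (λ ()) (λ ())
      gen (generator-point (# 1)) (generator-point (# 5)) (generator-point (# 2))

  point-generated : ∀ u → u < N → GeneratedPoint Generators (point u)
  point-generated 0 _ = generator-point (# 0)
  point-generated 1 _ = generator-point (# 1)
  point-generated 2 _ = generator-point (# 2)
  point-generated 3 _ = generator-point (# 3)
  point-generated 4 _ = generator-point (# 4)
  point-generated 5 _ = generator-point (# 5)
  point-generated (suc u@(suc (suc (suc (suc (suc j)))))) 1+u<N =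
    step-generated (pathCoordinates j)
      (point-generated u (<-trans (n<1+n u) 1+u<N))
      (fromℕ< 1+u<N , cong point (toℕ-fromℕ< 1+u<N))

  all-generated : ∀ x → Generated rel Generators x
  all-generated x = generated-of-point (point-generated (toℕ x) (toℕ<n x))

  rank3 : HasRank3 rel
  rank3 = # 0 , # 1 , # 2 , (λ ()) , (λ ()) , (λ ()) , refl

  no-projective-plane : ¬ ContainsProjectivePlane rel
  no-projective-plane plane with plane⇒quadrangle plane
  ... | _ , _ , _ , _ , Q = no-complete-quadrangle Q

lemma3p5 : (n : ℕ) →
    ∃[ R ] (IsSimpleMatroid {6 + suc n} R × HasRank3 R ×
      (∃[ p ] (Injective {A = Fin 6} _≡_ _≡_ p ×
               (∀ x → Generated R (λ y → ∃[ i ] p i ≡ y) x))) ×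
      ¬ ContainsProjectivePlane R)
lemma3p5 n = rel , isSimpleMatroid , rank3 , (generator , generator-injective , all-generated) , no-projective-plane
  where open Construction n
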